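{- For every integer $n\ge2$, all coefficients of the Ehrhart polynomial of the matroid polytope $\mathcal P(U^{2,n})$ of the uniform matroid of rank $2$ on $n$ elements are positive.
   Context: The uniform matroid $U^{r,n}$ on $[n]$ has as bases all $r$-subsets of $[n]$; its matroid polytope is $\mathcal P(U^{r,n})=\mathrm{conv}\{e_B: B\subseteq[n],|B|=r\}$ with $e_B=\sum_{i\in B}e_i$. The Ehrhart polynomial of an integral polytope $\mathcal P\subseteq\mathbb R^n$ is the polynomial $i(\mathcal P,k)=\#(k\mathcal P\cap\mathbb Z^n)$ in $k$. -}

module Defs where

open import Data.Nat using (ℕ; _≥_)
open import Data.Integer using (ℤ)
import Data.Integer as ℤ
open import Data.Rational using (ℚ; 0ℚ; 1ℚ; _+_; _*_; _≤_; _<_)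
import Data.Rational as ℚ
open import Data.Bool using (if_then_else_)
open import Data.Fin using (Fin)
open import Data.Fin.Subset using (Subset; ∣_∣)
open import Data.Vec using (Vec; lookup)
open import Data.List using (List; []; _∷_; length; map; foldr)
open import Data.List.Relation.Unary.All using (All)
open import Data.List.Relation.Unary.Unique.Propositional using (Unique)
open import Data.List.Membership.Propositional using (_∈_)
open import Data.Product using (Σ; _×_; proj₁; proj₂)
open import Function.Bundles using (_⇔_)
open import Relation.Binary.PropositionalEquality using (_≡_)

ℤ→ℚ : ℤ → ℚ
ℤ→ℚ z = z ℚ./ 1

ℕ→ℚ : ℕ → ℚ
ℕ→ℚ m = (ℤ.+ m) ℚ./ 1

indicator : ∀ {n} → Subset n → Fin n → ℚ
indicator B i = if lookup B i then 1ℚ else 0ℚ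

IsBasisU : (r : ℕ) → ∀ {n} → Subset n → Set
IsBasisU r B = ∣ B ∣ ≡ r

sumℚ : List ℚ → ℚ
sumℚ = foldr _+_ 0ℚ

-- A point y ∈ ℚ^n lies in P(U^{r,n}) = conv{e_B : |B| = r}:
-- y is a finite convex combination Σ λ_j e_{B_j} of basis indicator vectors.
InMatroidPolytopeU : (r : ℕ) → ∀ {n} → (Fin n → ℚ) → Set
InMatroidPolytopeU r {n} y =
  Σ (List (ℚ × Subset n)) λ comb →
      All (λ p → (0ℚ ≤ proj₁ p) × IsBasisU r (proj₂ p)) comb
    × (sumℚ (map proj₁ comb) ≡ 1ℚ)
    × (∀ i → y i ≡ sumℚ (map (λ p → proj₁ p * indicator (proj₂ p) i) comb))

InDilateU : (r : ℕ) → ∀ {n} → (k : ℕ) → Vec ℤ n → Set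
InDilateU r {n} k x =
  Σ (Fin n → ℚ) λ y → InMatroidPolytopeU r y × (∀ i → ℤ→ℚ (lookup x i) ≡ ℕ→ℚ k * y i)

-- L is a duplicate-free list of exactly the lattice points of k·P(U^{r,n}),
-- so length L = #(k·P(U^{r,n}) ∩ ℤ^n)
EnumeratesLatticePoints : (r n k : ℕ) → List (Vec ℤ n) → Set
EnumeratesLatticePoints r n k L = Unique L × (∀ x → (x ∈ L) ⇔ InDilateU r k x)

-- evaluation of the polynomial Σ_j cs[j] k^j (coefficient list, constant term first)
evalPoly : List ℚ → ℚ → ℚ
evalPoly [] t = 0ℚ
evalPoly (c ∷ cs) t = c + t * evalPoly cs t

module Submission where

-- Write N = n − 1.  A lattice point of k·P(U^{2,n}) is exactly a vector
-- v ∈ ℕⁿ with entries ≤ k and entry sum 2k: a convex combination of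
-- indicator vectors of 2-subsets has coordinates in [0,1] summing to 2, and
-- conversely a greedy argument writes such a v as the sum of the indicator
-- vectors of k two-element subsets, so v/k is their average.  Counting these
-- vectors by their first entry (a telescoping sum) gives, with the rising
-- factorial a⁽ᴺ⁾ = a(a+1)⋯(a+N−1),
--     N! · #(k·P(U^{2,n}) ∩ ℤⁿ) = (2k+1)⁽ᴺ⁾ − (N+1) · k⁽ᴺ⁾.
-- Expanding both rising factorials in powers of k, the coefficient of kʲ on
-- the right is 2ʲ·[xʲ](x+1)⁽ᴺ⁾ − (N+1)·[xʲ]x⁽ᴺ⁾; a recursion in N shows that
-- it is a positive integer for N ≥ 2 and 0 ≤ j ≤ N (for N = 1 the polytope is
-- a point and the polynomial is the constant 1).  Dividing by N! gives the
-- Ehrhart polynomial.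

module RationalEmbedding where

  open import Defs using (ℤ→ℚ; ℕ→ℚ)
  open import Data.Nat as ℕ using (ℕ)
  open import Data.Integer as ℤ using (ℤ; +_)
  import Data.Integer.Properties as ℤP
  open import Data.Rational as ℚ using (ℚ; mkℚ; 0ℚ; _+_; _*_; _≤_; _<_; *≤*; *<*)
  import Data.Rational.Properties as ℚP
  open import Data.Nat.Coprimality using (1-coprimeTo) renaming (sym to coprime-sym)
  open import Relation.Binary.PropositionalEquality

  -- The integer z seen as the normalised fraction z/1; 'z ℚ./ 1' reduces to it,
  -- and on this form every operation is computed by the integer operation.
  integral : ℤ → ℚ
  integral z = mkℚ z 0 (coprime-sym (1-coprimeTo ℤ.∣ z ∣))

  ℤ→ℚ≡integral : ∀ z → ℤ→ℚ z ≡ integral z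
  ℤ→ℚ≡integral z = ℚP.↥p/↧p≡p (integral z)

  ℤ→ℚ-+ : ∀ a b → ℤ→ℚ (a ℤ.+ b) ≡ ℤ→ℚ a + ℤ→ℚ b
  ℤ→ℚ-+ a b rewrite ℤ→ℚ≡integral a | ℤ→ℚ≡integral b =
    cong (ℚ._/ 1) (sym (cong₂ ℤ._+_ (ℤP.*-identityʳ a) (ℤP.*-identityʳ b)))

  ℤ→ℚ-* : ∀ a b → ℤ→ℚ (a ℤ.* b) ≡ ℤ→ℚ a * ℤ→ℚ b
  ℤ→ℚ-* a b rewrite ℤ→ℚ≡integral a | ℤ→ℚ≡integral b = refl

  ℤ→ℚ-mono-≤ : ∀ {a b} → a ℤ.≤ b → ℤ→ℚ a ≤ ℤ→ℚ b
  ℤ→ℚ-mono-≤ {a} {b} p rewrite ℤ→ℚ≡integral a | ℤ→ℚ≡integral b =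
    *≤* (subst₂ ℤ._≤_ (sym (ℤP.*-identityʳ a)) (sym (ℤP.*-identityʳ b)) p)

  ℤ→ℚ-cancel-≤ : ∀ {a b} → ℤ→ℚ a ≤ ℤ→ℚ b → a ℤ.≤ b
  ℤ→ℚ-cancel-≤ {a} {b} p rewrite ℤ→ℚ≡integral a | ℤ→ℚ≡integral b with p
  ... | *≤* q = subst₂ ℤ._≤_ (ℤP.*-identityʳ a) (ℤP.*-identityʳ b) q

  ℤ→ℚ-mono-< : ∀ {a b} → a ℤ.< b → ℤ→ℚ a < ℤ→ℚ b
  ℤ→ℚ-mono-< {a} {b} p rewrite ℤ→ℚ≡integral a | ℤ→ℚ≡integral b =
    *<* (subst₂ ℤ._<_ (sym (ℤP.*-identityʳ a)) (sym (ℤP.*-identityʳ b)) p)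

  ℤ→ℚ-injective : ∀ {a b} → ℤ→ℚ a ≡ ℤ→ℚ b → a ≡ b
  ℤ→ℚ-injective p =
    ℤP.≤-antisym (ℤ→ℚ-cancel-≤ (ℚP.≤-reflexive p)) (ℤ→ℚ-cancel-≤ (ℚP.≤-reflexive (sym p)))

  ℕ→ℚ-+ : ∀ a b → ℕ→ℚ (a ℕ.+ b) ≡ ℕ→ℚ a + ℕ→ℚ b
  ℕ→ℚ-+ a b = ℤ→ℚ-+ (+ a) (+ b)

  ℕ→ℚ-* : ∀ a b → ℕ→ℚ (a ℕ.* b) ≡ ℕ→ℚ a * ℕ→ℚ b
  ℕ→ℚ-* a b = trans (cong ℤ→ℚ (ℤP.pos-* a b)) (ℤ→ℚ-* (+ a) (+ b))

  ℕ→ℚ-injective : ∀ {a b} → ℕ→ℚ a ≡ ℕ→ℚ b → a ≡ b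
  ℕ→ℚ-injective p = ℤP.+-injective (ℤ→ℚ-injective p)

  ℕ→ℚ-nonNegative : ∀ m → 0ℚ ≤ ℕ→ℚ m
  ℕ→ℚ-nonNegative m = ℤ→ℚ-mono-≤ {+ 0} {+ m} (ℤ.+≤+ ℕ.z≤n)

  ℕ→ℚ-positive : ∀ {m} → 0 ℕ.< m → ℚ.Positive (ℕ→ℚ m)
  ℕ→ℚ-positive 0<m = ℚ.positive (ℤ→ℚ-mono-< (ℤ.+<+ 0<m))

module Polynomials where

  open import Data.Nat
  open import Data.Nat.Properties
  open import Data.Nat.Tactic.RingSolver using (solve-∀)
  open import Relation.Binary.PropositionalEquality
  open ≡-Reasoning

  -- A polynomial over ℕ is represented by its coefficient function f and a
  -- length bound L; 'horner f L x' evaluates Σ_{j<L} f j · xʲ by Horner's rule.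
  horner : (ℕ → ℕ) → ℕ → ℕ → ℕ
  horner f zero    x = 0
  horner f (suc L) x = f 0 + x * horner (λ j → f (suc j)) L x

  horner-cong : ∀ {f g} L x → (∀ j → f j ≡ g j) → horner f L x ≡ horner g L x
  horner-cong zero    x f≗g = refl
  horner-cong (suc L) x f≗g =
    cong₂ (λ u v → u + x * v) (f≗g 0) (horner-cong L x (λ j → f≗g (suc j)))

  horner-+ : ∀ f g L x → horner (λ j → f j + g j) L x ≡ horner f L x + horner g L x
  horner-+ f g zero    x = refl
  horner-+ f g (suc L) x
    rewrite horner-+ (λ j → f (suc j)) (λ j → g (suc j)) L x =
    rearrange (f 0) (g 0) x (horner (λ j → f (suc j)) L x) (horner (λ j → g (suc j)) L x)
    where
    rearrange : ∀ a b x u v → a + b + x * (u + v) ≡ a + x * u + (b + x * v)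
    rearrange = solve-∀

  horner-* : ∀ c f L x → horner (λ j → c * f j) L x ≡ c * horner f L x
  horner-* c f zero    x = sym (*-zeroʳ c)
  horner-* c f (suc L) x rewrite horner-* c (λ j → f (suc j)) L x =
    rearrange c (f 0) x (horner (λ j → f (suc j)) L x)
    where
    rearrange : ∀ c a x u → c * a + x * (c * u) ≡ c * (a + x * u)
    rearrange = solve-∀

  horner-scale : ∀ c f L x → horner f L (c * x) ≡ horner (λ j → c ^ j * f j) L x
  horner-scale c f zero    x = refl
  horner-scale c f (suc L) x = begin
      f 0 + c * x * horner f′ L (c * x)
    ≡⟨ cong (λ u → f 0 + c * x * u) (horner-scale c f′ L x) ⟩
      f 0 + c * x * horner (λ j → c ^ j * f′ j) L x
    ≡⟨ rearrange (f 0) c x _ ⟩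
      1 * f 0 + x * (c * horner (λ j → c ^ j * f′ j) L x)
    ≡⟨ cong (λ u → 1 * f 0 + x * u) (sym (horner-* c (λ j → c ^ j * f′ j) L x)) ⟩
      1 * f 0 + x * horner (λ j → c * (c ^ j * f′ j)) L x
    ≡⟨ cong (λ u → 1 * f 0 + x * u) (horner-cong L x (λ j → sym (*-assoc c (c ^ j) (f′ j)))) ⟩
      1 * f 0 + x * horner (λ j → c ^ suc j * f′ j) L x
    ∎
    where
    f′ : ℕ → ℕ
    f′ j = f (suc j)
    rearrange : ∀ a c x u → a + c * x * u ≡ 1 * a + x * (c * u)
    rearrange = solve-∀

  horner-drop-top : ∀ f L x → f L ≡ 0 → horner f (suc L) x ≡ horner f L x
  horner-drop-top f zero    x fL≡0 rewrite fL≡0 | *-zeroʳ x = refl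
  horner-drop-top f (suc L) x fL≡0 =
    cong (λ u → f 0 + x * u) (horner-drop-top (λ j → f (suc j)) L x fL≡0)

  -- The rising factorial a⁽ᵐ⁾ = a (a+1) ⋯ (a+m-1); a⁽ᵐ⁾/m! = C(a+m-1, m).
  rising : ℕ → ℕ → ℕ
  rising zero    a = 1
  rising (suc m) a = rising m a * (a + m)

  rising-1 : ∀ a → rising 1 a ≡ a
  rising-1 a = trans (*-identityˡ (a + 0)) (+-identityʳ a)

  rising-suc : ∀ m a → rising (suc m) a ≡ a * rising m (suc a)
  rising-suc zero    a = trans (rising-1 a) (sym (*-identityʳ a))
  rising-suc (suc m) a rewrite rising-suc m a | +-suc a m =
    *-assoc a (rising m (suc a)) (suc a + m)

  rising-zero : ∀ m → rising (suc m) 0 ≡ 0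
  rising-zero m = rising-suc m 0

  -- Pascal's rule C(a+m+1, m+1) = C(a+m, m+1) + C(a+m, m), multiplied by (m+1)!.
  rising-pascal : ∀ m a → rising (suc m) (suc a) ≡ rising (suc m) a + suc m * rising m (suc a)
  rising-pascal m a rewrite rising-suc m a = rearrange (rising m (suc a)) a m
    where
    rearrange : ∀ R a m → R * (suc a + m) ≡ a * R + suc m * R
    rearrange = solve-∀

  -- Pascal's rule written for an argument that may be 0 (where both sides vanish).
  rising-pascal∸ : ∀ m b →
    rising (suc (suc m)) b ≡ rising (suc (suc m)) (b ∸ 1) + suc (suc m) * rising (suc m) b
  rising-pascal∸ m zero rewrite rising-zero (suc m) | rising-zero m = sym (*-zeroʳ (suc (suc m)))
  rising-pascal∸ m (suc b) = rising-pascal (suc m) b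

  -- risingCoeff b N j is the coefficient of xʲ in (x+b)⁽ᴺ⁾, computed from
  -- (x+b)⁽ᴺ⁺¹⁾ = (x+b)⁽ᴺ⁾ · (x + (N+b)).
  risingCoeff : ℕ → ℕ → ℕ → ℕ
  risingCoeff b zero    zero    = 1
  risingCoeff b zero    (suc j) = 0
  risingCoeff b (suc N) zero    = (N + b) * risingCoeff b N zero
  risingCoeff b (suc N) (suc j) = (N + b) * risingCoeff b N (suc j) + risingCoeff b N j

  risingCoeff-beyond-degree : ∀ b N j → N < j → risingCoeff b N j ≡ 0
  risingCoeff-beyond-degree b zero    (suc j) _ = refl
  risingCoeff-beyond-degree b (suc N) (suc j) (s≤s N<j)
    rewrite risingCoeff-beyond-degree b N (suc j) (m≤n⇒m≤1+n N<j)
          | risingCoeff-beyond-degree b N j N<j =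
    trans (+-identityʳ _) (*-zeroʳ (N + b))

  rising-expansion : ∀ b N x → rising N (x + b) ≡ horner (risingCoeff b N) (suc N) x
  rising-expansion b zero    x = sym (cong suc (*-zeroʳ x))
  rising-expansion b (suc N) x = begin
      rising N (x + b) * (x + b + N)
    ≡⟨ cong (_* (x + b + N)) (rising-expansion b N x) ⟩
      (c 0 + x * P′) * (x + b + N)
    ≡⟨ rearrange (c 0) x P′ N b ⟩
      (N + b) * c 0 + x * ((N + b) * P′ + (c 0 + x * P′))
    ≡⟨ cong (λ u → (N + b) * c 0 + x * ((N + b) * u + (c 0 + x * P′))) (sym top-vanishes) ⟩
      (N + b) * c 0 + x * ((N + b) * P + horner c (suc N) x)
    ≡⟨ cong (λ u → (N + b) * c 0 + x * (u + horner c (suc N) x))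
            (sym (horner-* (N + b) (λ j → c (suc j)) (suc N) x)) ⟩
      (N + b) * c 0 + x * (horner (λ j → (N + b) * c (suc j)) (suc N) x + horner c (suc N) x)
    ≡⟨ cong (λ u → (N + b) * c 0 + x * u)
            (sym (horner-+ (λ j → (N + b) * c (suc j)) c (suc N) x)) ⟩
      horner (risingCoeff b (suc N)) (suc (suc N)) x
    ∎
    where
    c : ℕ → ℕ
    c = risingCoeff b N
    P P′ : ℕ
    P  = horner (λ j → c (suc j)) (suc N) x
    P′ = horner (λ j → c (suc j)) N x
    top-vanishes : P ≡ P′
    top-vanishes = horner-drop-top (λ j → c (suc j)) N x
                     (risingCoeff-beyond-degree b N (suc N) (n<1+n N))
    rearrange : ∀ c₀ x P N b →
      (c₀ + x * P) * (x + b + N) ≡ (N + b) * c₀ + x * ((N + b) * P + (c₀ + x * P))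
    rearrange = solve-∀

module EhrhartCoefficients where

  open import Data.Nat
  open import Data.Nat.Properties
  open import Data.Nat.Tactic.RingSolver using (solve-∀)
  open import Data.Sum using (inj₁; inj₂)
  open import Data.Product using (Σ; _×_; _,_)
  open import Relation.Binary.PropositionalEquality
  open ≡-Reasoning
  open Polynomials

  -- numerator N j is N! times the j-th coefficient of the Ehrhart polynomial of
  -- P(U^{2,N+1}): the coefficient of kʲ in (2k+1)⁽ᴺ⁾ − (N+1)·k⁽ᴺ⁾, i.e.
  -- 2ʲ·risingCoeff 1 N j − (N+1)·risingCoeff 0 N j.  The recursion is the one
  -- forced by the recursions of the two rising-factorial coefficients.
  numerator : ℕ → ℕ → ℕ
  numerator zero    j       = 0
  numerator (suc N) zero    = suc N * numerator N zero + risingCoeff 0 N zero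
  numerator (suc N) (suc j) =
    suc N * numerator N (suc j) + 2 * numerator N j + risingCoeff 0 N (suc j) + N * risingCoeff 0 N j

  numerator-spec : ∀ N j → 2 ^ j * risingCoeff 1 N j ≡ suc N * risingCoeff 0 N j + numerator N j
  numerator-spec zero    zero    = refl
  numerator-spec zero    (suc j) = *-zeroʳ (2 ^ suc j)
  numerator-spec (suc N) zero    = begin
      1 * ((N + 1) * risingCoeff 1 N 0)
    ≡⟨ cong (λ u → 1 * ((N + 1) * u)) (trans (sym (*-identityˡ _)) (numerator-spec N 0)) ⟩
      1 * ((N + 1) * (suc N * a + numerator N 0))
    ≡⟨ rearrange N a (numerator N 0) ⟩
      suc (suc N) * ((N + 0) * a) + (suc N * numerator N 0 + a)
    ∎
    where
    a : ℕ
    a = risingCoeff 0 N 0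
    rearrange : ∀ N a d → 1 * ((N + 1) * (suc N * a + d)) ≡ suc (suc N) * ((N + 0) * a) + (suc N * d + a)
    rearrange = solve-∀
  numerator-spec (suc N) (suc j) = begin
      2 ^ suc j * ((N + 1) * risingCoeff 1 N (suc j) + risingCoeff 1 N j)
    ≡⟨ split-power N j (risingCoeff 1 N (suc j)) (risingCoeff 1 N j) ⟩
      (N + 1) * (2 ^ suc j * risingCoeff 1 N (suc j)) + 2 * (2 ^ j * risingCoeff 1 N j)
    ≡⟨ cong₂ (λ u v → (N + 1) * u + 2 * v) (numerator-spec N (suc j)) (numerator-spec N j) ⟩
      (N + 1) * (suc N * a′ + numerator N (suc j)) + 2 * (suc N * a + numerator N j)
    ≡⟨ rearrange N a′ a (numerator N (suc j)) (numerator N j) ⟩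
      suc (suc N) * ((N + 0) * a′ + a)
        + (suc N * numerator N (suc j) + 2 * numerator N j + a′ + N * a)
    ∎
    where
    a a′ : ℕ
    a  = risingCoeff 0 N j
    a′ = risingCoeff 0 N (suc j)
    split-power : ∀ N j u v →
      2 ^ suc j * ((N + 1) * u + v) ≡ (N + 1) * (2 ^ suc j * u) + 2 * (2 ^ j * v)
    split-power N j u v
      rewrite *-distribˡ-+ (2 ^ suc j) ((N + 1) * u) v
            | sym (*-assoc (2 ^ suc j) (N + 1) u) | *-comm (2 ^ suc j) (N + 1)
            | *-assoc (N + 1) (2 ^ suc j) u | *-assoc 2 (2 ^ j) v = refl
    rearrange : ∀ N a′ a d′ d →
      (N + 1) * (suc N * a′ + d′) + 2 * (suc N * a + d)
        ≡ suc (suc N) * ((N + 0) * a′ + a) + (suc N * d′ + 2 * d + a′ + N * a)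
    rearrange = solve-∀

  rising-difference : ∀ N k →
    rising N (2 * k + 1) ≡ horner (numerator N) (suc N) k + suc N * rising N k
  rising-difference N k = begin
      rising N (2 * k + 1)
    ≡⟨ rising-expansion 1 N (2 * k) ⟩
      horner (risingCoeff 1 N) (suc N) (2 * k)
    ≡⟨ horner-scale 2 (risingCoeff 1 N) (suc N) k ⟩
      horner (λ j → 2 ^ j * risingCoeff 1 N j) (suc N) k
    ≡⟨ horner-cong (suc N) k (numerator-spec N) ⟩
      horner (λ j → suc N * risingCoeff 0 N j + numerator N j) (suc N) k
    ≡⟨ horner-+ (λ j → suc N * risingCoeff 0 N j) (numerator N) (suc N) k ⟩
      horner (λ j → suc N * risingCoeff 0 N j) (suc N) k + horner (numerator N) (suc N) k
    ≡⟨ cong (_+ horner (numerator N) (suc N) k) (horner-* (suc N) (risingCoeff 0 N) (suc N) k) ⟩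
      suc N * horner (risingCoeff 0 N) (suc N) k + horner (numerator N) (suc N) k
    ≡⟨ cong (λ u → suc N * u + horner (numerator N) (suc N) k) (sym k⁽ᴺ⁾-expansion) ⟩
      suc N * rising N k + horner (numerator N) (suc N) k
    ≡⟨ +-comm (suc N * rising N k) (horner (numerator N) (suc N) k) ⟩
      horner (numerator N) (suc N) k + suc N * rising N k
    ∎
    where
    k⁽ᴺ⁾-expansion : rising N k ≡ horner (risingCoeff 0 N) (suc N) k
    k⁽ᴺ⁾-expansion = trans (cong (rising N) (sym (+-identityʳ k))) (rising-expansion 0 N k)

  numerator-expansion : ∀ N k B → N ! * B + suc N * rising N k ≡ rising N (2 * k + 1) →
    N ! * B ≡ horner (numerator N) (suc N) k
  numerator-expansion N k B eq =
    +-cancelʳ-≡ (suc N * rising N k) _ _ (trans eq (rising-difference N k))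

  positive-* : ∀ {a b} → 0 < a → 0 < b → 0 < a * b
  positive-* = *-mono-<

  risingCoeff-positive : ∀ N j → 1 ≤ j → j ≤ N → 0 < risingCoeff 0 N j
  risingCoeff-positive (suc zero)    (suc zero)    _ _ = s≤s z≤n
  risingCoeff-positive (suc (suc N)) (suc zero)    _ _ =
    <-≤-trans (positive-* {suc N + 0} z<s (risingCoeff-positive (suc N) 1 (s≤s z≤n) (s≤s z≤n)))
              (m≤m+n _ (risingCoeff 0 (suc N) 0))
  risingCoeff-positive (suc N)       (suc (suc j)) _ (s≤s j<N) =
    <-≤-trans (risingCoeff-positive N (suc j) (s≤s z≤n) j<N)
              (m≤n+m _ ((N + 0) * risingCoeff 0 N (suc (suc j))))

  -- The constant coefficient (it equals N!, as there is one point for k = 0).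
  numerator-constant-positive : ∀ M → 0 < numerator (suc M) 0
  numerator-constant-positive zero    = s≤s z≤n
  numerator-constant-positive (suc M) =
    <-≤-trans (positive-* {suc (suc M)} z<s (numerator-constant-positive M))
              (m≤m+n _ (risingCoeff 0 (suc M) 0))

  -- For N ≥ 2 all N+1 coefficients are positive: in the recursion for
  -- numerator (M+1) (i+1) the summand risingCoeff 0 M (i+1) is positive when
  -- i < M, and the summand M·risingCoeff 0 M M when i = M (this needs M ≥ 1).
  numerator-positive : ∀ N j → 2 ≤ N → j ≤ N → 0 < numerator N j
  numerator-positive (suc M) zero    _               _         = numerator-constant-positive M
  numerator-positive (suc M) (suc i) (s≤s (s≤s _)) (s≤s i≤M) with m≤n⇒m<n∨m≡n i≤M
  ... | inj₁ i<M  = <-≤-trans (risingCoeff-positive M (suc i) (s≤s z≤n) i<M)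
                     (≤-trans (m≤n+m _ (suc M * numerator M (suc i) + 2 * numerator M i))
                              (m≤m+n _ (M * risingCoeff 0 M i)))
  ... | inj₂ refl = <-≤-trans (positive-* {M} (≤-trans (s≤s z≤n) i≤M)
                                (risingCoeff-positive M M (≤-trans (s≤s z≤n) i≤M) ≤-refl))
                     (m≤n+m (M * risingCoeff 0 M M)
                            (suc M * numerator M (suc M) + 2 * numerator M M + risingCoeff 0 M (suc M)))

  -- The coefficients that are actually needed: all N+1 of them when N ≥ 2, and
  -- only the constant one when N = 1 (then P(U^{2,2}) is a point).
  numerator-support : ∀ m → Σ ℕ λ L →
    (∀ j → j < L → 0 < numerator (suc m) j) ×
    (∀ k → horner (numerator (suc m)) (suc (suc m)) k ≡ horner (numerator (suc m)) L k)
  numerator-support zero    = 1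
    , (λ { zero _ → s≤s z≤n ; (suc j) (s≤s ()) })
    , λ k → horner-drop-top (numerator 1) 1 k refl
  numerator-support (suc m) = suc (suc (suc m))
    , (λ j j<L → numerator-positive (suc (suc m)) j (s≤s (s≤s z≤n)) (≤-pred j<L))
    , λ k → refl

module BoundedVectors where

  open import Data.Nat
  open import Data.Nat.Properties
  open import Data.Fin using (zero; suc)
  open import Data.Vec using (Vec; []; _∷_; lookup; head; tail; sum)
  open import Data.List using (List; []; _∷_; map; _++_)
  open import Data.List.Membership.Propositional using (_∈_)
  open import Data.List.Membership.Propositional.Properties using (∈-map⁺; ∈-map⁻; ∈-++⁺ˡ; ∈-++⁺ʳ; ∈-++⁻)
  open import Data.List.Relation.Unary.Any using (here)
  open import Data.List.Relation.Unary.Unique.Propositional using (Unique)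
  import Data.List.Relation.Unary.Unique.Propositional.Properties as Unique
  open import Data.List.Relation.Unary.AllPairs using ([]; _∷_)
  open import Data.List.Relation.Unary.All using ([])
  open import Data.Product using (_×_; _,_; proj₁)
  open import Data.Sum using (inj₁; inj₂)
  open import Relation.Nullary using (yes; no; ¬_)
  open import Relation.Binary.PropositionalEquality
  open import Data.Empty using (⊥-elim)

  Bounded : ∀ {n} → ℕ → ℕ → Vec ℕ n → Set
  Bounded k s v = (∀ i → lookup v i ≤ k) × sum v ≡ s

  -- 'bounded n k s' lists the vectors of ℕⁿ with entries ≤ k and sum s;
  -- 'withHeadUpTo n k s j' lists those in ℕⁿ⁺¹ whose first entry is at most j,
  -- grouped by the value of the first entry (largest first).
  mutual
    bounded : (n k s : ℕ) → List (Vec ℕ n)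
    bounded zero    k zero    = [] ∷ []
    bounded zero    k (suc s) = []
    bounded (suc n) k s       = withHeadUpTo n k s k

    withHeadUpTo : (n k s j : ℕ) → List (Vec ℕ (suc n))
    withHeadUpTo n k s zero = map (0 ∷_) (bounded n k s)
    withHeadUpTo n k s (suc j) with suc j ≤? s
    ... | yes _ = map (suc j ∷_) (bounded n k (s ∸ suc j)) ++ withHeadUpTo n k s j
    ... | no  _ = withHeadUpTo n k s j

  raise-head-bound : ∀ {a j} {B C : Set} → a ≤ j × B × C → a ≤ suc j × B × C
  raise-head-bound (a≤j , b , c) = m≤n⇒m≤1+n a≤j , b , c

  mutual
    bounded-sound : ∀ n k s v → v ∈ bounded n k s → Bounded k s v
    bounded-sound zero    k zero    []      _ = (λ ()) , refl
    bounded-sound zero    k (suc s) v       ()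
    bounded-sound (suc n) k s       (e ∷ t) v∈
      with withHeadUpTo-sound n k s k (e ∷ t) v∈
    ... | e≤k , e≤s , t∈ with bounded-sound n k (s ∸ e) t t∈
    ... | t≤k , Σt =
      (λ { zero → e≤k ; (suc i) → t≤k i }) , trans (cong (e +_) Σt) (m+[n∸m]≡n e≤s)

    withHeadUpTo-sound : ∀ n k s j w → w ∈ withHeadUpTo n k s j →
      head w ≤ j × head w ≤ s × tail w ∈ bounded n k (s ∸ head w)
    withHeadUpTo-sound n k s zero w w∈ with ∈-map⁻ (0 ∷_) w∈
    ... | t , t∈ , refl = z≤n , z≤n , t∈
    withHeadUpTo-sound n k s (suc j) w w∈ with suc j ≤? s
    ... | no _ = raise-head-bound (withHeadUpTo-sound n k s j w w∈)
    ... | yes j<s with ∈-++⁻ (map (suc j ∷_) (bounded n k (s ∸ suc j))) w∈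
    ... | inj₂ w∈′ = raise-head-bound (withHeadUpTo-sound n k s j w w∈′)
    ... | inj₁ w∈′ with ∈-map⁻ (suc j ∷_) w∈′
    ... | t , t∈ , refl = ≤-refl , j<s , t∈

  mutual
    bounded-complete : ∀ n k s v → Bounded k s v → v ∈ bounded n k s
    bounded-complete zero    k zero    []      _          = here refl
    bounded-complete zero    k (suc s) []      (_ , ())
    bounded-complete (suc n) k s       (e ∷ t) (v≤k , Σv) =
      withHeadUpTo-complete n k s k e t (v≤k zero) e≤s
        (bounded-complete n k (s ∸ e) t ((λ i → v≤k (suc i)) , Σt))
      where
      e≤s : e ≤ s
      e≤s = subst (e ≤_) Σv (m≤m+n e (sum t))
      Σt : sum t ≡ s ∸ e
      Σt = sym (trans (cong (_∸ e) (sym Σv)) (m+n∸m≡n e (sum t)))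

    withHeadUpTo-complete : ∀ n k s j e t → e ≤ j → e ≤ s → t ∈ bounded n k (s ∸ e) →
      (e ∷ t) ∈ withHeadUpTo n k s j
    withHeadUpTo-complete n k s zero    zero t _   _   t∈ = ∈-map⁺ (0 ∷_) t∈
    withHeadUpTo-complete n k s (suc j) e    t e≤j e≤s t∈ with suc j ≤? s | m≤n⇒m<n∨m≡n e≤j
    ... | yes _   | inj₂ refl        = ∈-++⁺ˡ (∈-map⁺ (suc j ∷_) t∈)
    ... | yes _   | inj₁ (s≤s e≤j′) =
      ∈-++⁺ʳ (map (suc j ∷_) (bounded n k (s ∸ suc j))) (withHeadUpTo-complete n k s j e t e≤j′ e≤s t∈)
    ... | no  j≰s | inj₂ refl        = ⊥-elim (j≰s e≤s)
    ... | no  _   | inj₁ (s≤s e≤j′) = withHeadUpTo-complete n k s j e t e≤j′ e≤s t∈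

  ∷-injectiveʳ : ∀ {n} (e : ℕ) {x y : Vec ℕ n} → e ∷ x ≡ e ∷ y → x ≡ y
  ∷-injectiveʳ e refl = refl

  mutual
    bounded-unique : ∀ n k s → Unique (bounded n k s)
    bounded-unique zero    k zero    = [] ∷ []
    bounded-unique zero    k (suc s) = []
    bounded-unique (suc n) k s       = withHeadUpTo-unique n k s k

    withHeadUpTo-unique : ∀ n k s j → Unique (withHeadUpTo n k s j)
    withHeadUpTo-unique n k s zero = Unique.map⁺ (∷-injectiveʳ 0) (bounded-unique n k s)
    withHeadUpTo-unique n k s (suc j) with suc j ≤? s
    ... | no  _ = withHeadUpTo-unique n k s j
    ... | yes _ =
      Unique.++⁺ (Unique.map⁺ (∷-injectiveʳ (suc j)) (bounded-unique n k (s ∸ suc j)))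
                 (withHeadUpTo-unique n k s j) disjoint
      where
      -- the new block has first entry j+1, the rest have first entry ≤ j
      disjoint : ∀ {v} → ¬ (v ∈ map (suc j ∷_) (bounded n k (s ∸ suc j)) × v ∈ withHeadUpTo n k s j)
      disjoint (v∈new , v∈old) with ∈-map⁻ (suc j ∷_) v∈new
      ... | t , _ , refl = 1+n≰n (proj₁ (withHeadUpTo-sound n k s j (suc j ∷ t) v∈old))

module BoundedCount where

  open import Data.Nat
  open import Data.Nat.Properties
  open import Data.Nat.Tactic.RingSolver using (solve-∀)
  open import Data.Vec using (Vec; _∷_)
  open import Data.List using (List; []; map; _++_; length)
  open import Data.List.Properties using (length-map; length-++)
  open import Relation.Nullary using (yes; no)
  open import Relation.Binary.PropositionalEquality
  open ≡-Reasoning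
  open import Data.Empty using (⊥-elim)
  open Polynomials using (rising; rising-1; rising-zero; rising-pascal; rising-pascal∸)
  open BoundedVectors using (bounded; withHeadUpTo)

  -- The number of v ∈ ℕᴺ⁺¹ with entries ≤ k and sum s ≤ 2k is
  --   C(s+N, N) − (N+1)·C(s−k−1+N, N)
  -- (at most one entry can exceed k), which after multiplying by N! reads as
  -- below (for N ≥ 1 only: subtraction is truncated, and (s ∸ k)⁽ᴺ⁾ must vanish
  -- exactly when s ≤ k).
  CountFormula : ℕ → ℕ → Set
  CountFormula k N = ∀ s → s ≤ 2 * k →
    N ! * length (bounded (suc N) k s) + suc N * rising N (s ∸ k) ≡ rising N (suc s)

  -- The same count for n+1 entries after an application of Pascal's rule, a
  -- form that (unlike CountFormula) already holds for a single entry.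
  PascalForm : ℕ → ℕ → Set
  PascalForm k n = ∀ r → r ≤ 2 * k →
    suc n ! * length (bounded (suc n) k r) + rising (suc n) r + suc n * rising (suc n) (r ∸ k)
      ≡ rising (suc n) (suc r) + suc n * rising (suc n) (r ∸ 1 ∸ k)

  ∸-swap-1 : ∀ r k → r ∸ 1 ∸ k ≡ r ∸ k ∸ 1
  ∸-swap-1 r k = trans (∸-+-assoc r 1 k) (trans (cong (r ∸_) (+-comm 1 k)) (sym (∸-+-assoc r k 1)))

  length-block : ∀ {n} e (xs : List (Vec ℕ n)) (ys : List (Vec ℕ (suc n))) → length (map (e ∷_) xs ++ ys) ≡ length xs + length ys
  length-block e xs ys = trans (length-++ (map (e ∷_) xs)) (cong (_+ length ys) (length-map (e ∷_) xs))

  nothing-left : ∀ k t → 0 < t → bounded 0 k t ≡ []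
  nothing-left k (suc t) _ = refl

  mutual
    single-entry-present : ∀ k r j → r ≤ j → length (withHeadUpTo 0 k r j) ≡ 1
    single-entry-present k zero zero _ = refl
    single-entry-present k r (suc j) r≤j+1 with suc j ≤? r
    ... | no  j+1≰r = single-entry-present k r j (≮⇒≥ j+1≰r)
    ... | yes j+1≤r rewrite ≤-antisym r≤j+1 j+1≤r
                          | length-block (suc j) (bounded 0 k (suc j ∸ suc j)) (withHeadUpTo 0 k (suc j) j)
                          | n∸n≡0 j = cong suc (single-entry-absent k (suc j) j ≤-refl)

    single-entry-absent : ∀ k r j → j < r → length (withHeadUpTo 0 k r j) ≡ 0
    single-entry-absent k (suc r) zero _ = refl
    single-entry-absent k r (suc j) j+1<r with suc j ≤? r
    ... | no  j+1≰r = ⊥-elim (j+1≰r (<⇒≤ j+1<r))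
    ... | yes _ rewrite length-block (suc j) (bounded 0 k (r ∸ suc j)) (withHeadUpTo 0 k r j)
                      | nothing-left k (r ∸ suc j) (m<n⇒0<n∸m j+1<r) =
      single-entry-absent k r j (<-trans (n<1+n j) j+1<r)

  single-entry-identity : ∀ k r → length (withHeadUpTo 0 k r k) + r + (r ∸ k) ≡ suc r + (r ∸ 1 ∸ k)
  single-entry-identity k r rewrite ∸-swap-1 r k with r ≤? k
  ... | yes r≤k rewrite single-entry-present k r k r≤k | m≤n⇒m∸n≡0 r≤k = refl
  ... | no  r≰k with r ∸ k | m<n⇒0<n∸m (≰⇒> r≰k)
  ... | suc d | _ rewrite single-entry-absent k r k (≰⇒> r≰k) = +-suc r d

  pascalForm-single : ∀ k → PascalForm k 0
  pascalForm-single k r _ = begin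
      1 * L + rising 1 r + 1 * rising 1 (r ∸ k)
    ≡⟨ cong₂ (λ a b → 1 * L + a + 1 * b) (rising-1 r) (rising-1 (r ∸ k)) ⟩
      1 * L + r + 1 * (r ∸ k)
    ≡⟨ cong₂ (λ a b → a + r + b) (*-identityˡ L) (*-identityˡ (r ∸ k)) ⟩
      L + r + (r ∸ k)
    ≡⟨ single-entry-identity k r ⟩
      suc r + (r ∸ 1 ∸ k)
    ≡⟨ cong₂ (λ a b → a + b) (sym (rising-1 (suc r)))
                             (sym (trans (*-identityˡ _) (rising-1 (r ∸ 1 ∸ k)))) ⟩
      rising 1 (suc r) + 1 * rising 1 (r ∸ 1 ∸ k)
    ∎
    where
    L : ℕ
    L = length (withHeadUpTo 0 k r k)

  -- The arithmetic behind one telescoping step: the partial count over first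
  -- entries ≤ j plus the count of the block with first entry j+1.
  telescope-step : ∀ X L B Ra Ra′ Rsk Rs Rak Ra1k c →
    X * L + Ra′ + c * Rsk ≡ Rs + c * Rak →
    X * B + Ra + c * Rak ≡ Ra′ + c * Ra1k →
    X * (B + L) + Ra + c * Rsk ≡ Rs + c * Ra1k
  telescope-step X L B Ra Ra′ Rsk Rs Rak Ra1k c partial block =
    +-cancelʳ-≡ (Ra′ + c * Rak) _ _
      (trans (regroupˡ X L B Ra Ra′ Rsk Rak c)
      (trans (cong₂ _+_ partial block) (regroupʳ Rs Rak Ra′ Ra1k c)))
    where
    regroupˡ : ∀ X L B Ra Ra′ Rsk Rak c →
      X * (B + L) + Ra + c * Rsk + (Ra′ + c * Rak) ≡ (X * L + Ra′ + c * Rsk) + (X * B + Ra + c * Rak)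
    regroupˡ = solve-∀
    regroupʳ : ∀ Rs Rak Ra′ Ra1k c → (Rs + c * Rak) + (Ra′ + c * Ra1k) ≡ Rs + c * Ra1k + (Ra′ + c * Rak)
    regroupʳ = solve-∀

  ∸-pred : ∀ s j → suc j ≤ s → s ∸ j ≡ suc (s ∸ suc j)
  ∸-pred (suc s) zero    _         = refl
  ∸-pred (suc s) (suc j) (s≤s j<s) = ∸-pred s j j<s

  ∸-suc-suc : ∀ s j → s ∸ suc (suc j) ≡ s ∸ suc j ∸ 1
  ∸-suc-suc s j = trans (cong (s ∸_) (+-comm 1 (suc j))) (sym (∸-+-assoc s (suc j) 1))

  -- Counting the vectors of ℕⁿ⁺² with first entry ≤ j by summing the
  -- (n+1)-entry counts, in PascalForm, over the first entry; the sum telescopes.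
  module PartialCount (k n : ℕ) (pascal : PascalForm k n) (s : ℕ) (s≤2k : s ≤ 2 * k) where

    private
      X c : ℕ
      X = suc n !
      c = suc n
      R : ℕ → ℕ
      R = rising (suc n)
      L : ℕ → ℕ
      L j = length (withHeadUpTo (suc n) k s j)

    partial-count : ∀ j → X * L j + R (s ∸ j) + c * R (s ∸ k) ≡ R (suc s) + c * R (s ∸ suc j ∸ k)
    partial-count zero =
      trans (cong (λ u → X * u + R s + c * R (s ∸ k)) (length-map (0 ∷_) (bounded (suc n) k s)))
            (pascal s s≤2k)
    partial-count (suc j) with suc j ≤? s
    ... | no j+1≰s =
      subst₂ (λ a b → X * L j + R a + c * R (s ∸ k) ≡ R (suc s) + c * R b)
             (trans (m≤n⇒m∸n≡0 s≤j) (sym (m≤n⇒m∸n≡0 (m≤n⇒m≤1+n s≤j))))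
             (cong (_∸ k) (trans (m≤n⇒m∸n≡0 (m≤n⇒m≤1+n s≤j))
                                 (sym (m≤n⇒m∸n≡0 (m≤n⇒m≤1+n (m≤n⇒m≤1+n s≤j))))))
             (partial-count j)
      where
      s≤j : s ≤ j
      s≤j = ≮⇒≥ j+1≰s
    ... | yes j+1≤s =
      trans (cong (λ u → X * u + R a + c * R (s ∸ k)) (length-block (suc j) (bounded (suc n) k a) _))
            (subst (λ b → X * (B + L j) + R a + c * R (s ∸ k) ≡ R (suc s) + c * R b)
                   (sym (cong (_∸ k) (∸-suc-suc s j)))
                   (telescope-step X (L j) B (R a) (R (suc a)) (R (s ∸ k)) (R (suc s))
                                   (R (a ∸ k)) (R (a ∸ 1 ∸ k)) c
                                   up-to-j (pascal a (≤-trans (m∸n≤m s (suc j)) s≤2k))))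
      where
      a B : ℕ
      a = s ∸ suc j
      B = length (bounded (suc n) k a)
      up-to-j : X * L j + R (suc a) + c * R (s ∸ k) ≡ R (suc s) + c * R (a ∸ k)
      up-to-j = subst (λ u → X * L j + R u + c * R (s ∸ k) ≡ R (suc s) + c * R (a ∸ k))
                      (∸-pred s j j+1≤s) (partial-count j)

  -- Summing over all admissible first entries 0..k gives the count for n+2 entries;
  -- the last telescoped term vanishes because s ∸ (k+1) ∸ k = 0 for s ≤ 2k.
  countFormula-from-pascal : ∀ k n → PascalForm k n → CountFormula k (suc n)
  countFormula-from-pascal k n pascal s s≤2k = begin
      X * L + suc c * R (s ∸ k)
    ≡⟨ regroup X L (R (s ∸ k)) c ⟩
      X * L + R (s ∸ k) + c * R (s ∸ k)
    ≡⟨ PartialCount.partial-count k n pascal s s≤2k k ⟩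
      R (suc s) + c * R (s ∸ suc k ∸ k)
    ≡⟨ cong (λ u → R (suc s) + c * u) last-term-vanishes ⟩
      R (suc s) + c * 0
    ≡⟨ cong (R (suc s) +_) (*-zeroʳ c) ⟩
      R (suc s) + 0
    ≡⟨ +-identityʳ _ ⟩
      R (suc s)
    ∎
    where
    X c L : ℕ
    X = suc n !
    c = suc n
    L = length (bounded (suc (suc n)) k s)
    R : ℕ → ℕ
    R = rising (suc n)
    regroup : ∀ X L R c → X * L + suc c * R ≡ X * L + R + c * R
    regroup = solve-∀
    s≤k+1+k : s ≤ suc k + k
    s≤k+1+k = ≤-trans s≤2k (≤-trans (≤-reflexive (cong (k +_) (+-identityʳ k))) (n≤1+n _))
    last-term-vanishes : R (s ∸ suc k ∸ k) ≡ 0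
    last-term-vanishes rewrite ∸-+-assoc s (suc k) k | m≤n⇒m∸n≡0 s≤k+1+k = rising-zero n

  pascal-from-countFormula : ∀ k n → CountFormula k (suc n) → PascalForm k (suc n)
  pascal-from-countFormula k n count r r≤2k = begin
      c′ * X * B + R′ r + c′ * R′ (r ∸ k)
    ≡⟨ cong (λ u → c′ * X * B + R′ r + c′ * u) (rising-pascal∸ n (r ∸ k)) ⟩
      c′ * X * B + R′ r + c′ * (R′ (r ∸ k ∸ 1) + c′ * R (r ∸ k))
    ≡⟨ regroup c′ X B (R′ r) (R′ (r ∸ k ∸ 1)) (R (r ∸ k)) ⟩
      R′ r + c′ * (X * B + c′ * R (r ∸ k)) + c′ * R′ (r ∸ k ∸ 1)
    ≡⟨ cong (λ u → R′ r + c′ * u + c′ * R′ (r ∸ k ∸ 1)) (count r r≤2k) ⟩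
      R′ r + c′ * R (suc r) + c′ * R′ (r ∸ k ∸ 1)
    ≡⟨ cong₂ (λ u v → u + c′ * R′ v) (sym (rising-pascal (suc n) r)) (sym (∸-swap-1 r k)) ⟩
      R′ (suc r) + c′ * R′ (r ∸ 1 ∸ k)
    ∎
    where
    c′ X B : ℕ
    c′ = suc (suc n)
    X  = suc n !
    B  = length (bounded (suc (suc n)) k r)
    R R′ : ℕ → ℕ
    R  = rising (suc n)
    R′ = rising (suc (suc n))
    regroup : ∀ c X B a b d → c * X * B + a + c * (b + c * d) ≡ a + c * (X * B + c * d) + c * b
    regroup = solve-∀

  pascalForm : ∀ k n → PascalForm k n
  pascalForm k zero    = pascalForm-single k
  pascalForm k (suc n) = pascal-from-countFormula k n (countFormula-from-pascal k n (pascalForm k n))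

  countFormula : ∀ k n → CountFormula k (suc n)
  countFormula k n = countFormula-from-pascal k n (pascalForm k n)

module Decomposition where

  open import Data.Nat
  open import Data.Nat.Properties
  open import Data.Nat.Tactic.RingSolver using (solve-∀)
  open import Data.Bool using (true; false; if_then_else_)
  open import Data.Fin using (Fin; zero; suc)
  open import Data.Fin.Subset using (Subset; ∣_∣; ⁅_⁆) renaming (⊥ to ∅)
  open import Data.Fin.Subset.Properties using (∣⁅x⁆∣≡1)
  open import Data.Vec using (Vec; []; _∷_; lookup; sum)
  open import Data.Vec.Properties using (lookup-replicate)
  open import Data.List using (List; []; _∷_; map; _++_; length; take; drop; replicate)
  open import Data.List.Properties using (length-map; length-++; length-take; length-drop; take++drop≡id; length-replicate)
  open import Data.List.Relation.Unary.All using (All; [])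
  open import Data.List.Relation.Unary.All.Properties using (map⁺; gmap⁺; replicate⁺; take⁺; drop⁺; ++⁺)
  open import Data.Product using (_×_; _,_; Σ; proj₁; proj₂)
  open import Data.Sum using (_⊎_; inj₁; inj₂; map₂)
  open import Relation.Nullary using (yes; no)
  open import Relation.Binary.PropositionalEquality
  open ≡-Reasoning

  -- member B i is 1 if i ∈ B and 0 otherwise; multiplicity Bs i counts the
  -- members of the family Bs containing i, so it is the i-th entry of Σ e_B.
  member : ∀ {n} → Subset n → Fin n → ℕ
  member B i = if lookup B i then 1 else 0

  multiplicity : ∀ {n} → List (Subset n) → Fin n → ℕ
  multiplicity []       i = 0
  multiplicity (B ∷ Bs) i = member B i + multiplicity Bs i

  multiplicity-++ : ∀ {n} (Bs Cs : List (Subset n)) i →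
    multiplicity (Bs ++ Cs) i ≡ multiplicity Bs i + multiplicity Cs i
  multiplicity-++ []       Cs i = refl
  multiplicity-++ (B ∷ Bs) Cs i rewrite multiplicity-++ Bs Cs i = sym (+-assoc (member B i) _ _)

  multiplicity-take-drop : ∀ {n} r (Bs : List (Subset n)) i →
    multiplicity (take r Bs) i + multiplicity (drop r Bs) i ≡ multiplicity Bs i
  multiplicity-take-drop r Bs i =
    trans (sym (multiplicity-++ (take r Bs) (drop r Bs) i)) (cong (λ Cs → multiplicity Cs i) (take++drop≡id r Bs))

  multiplicity-lift-new : ∀ {n} (Bs : List (Subset n)) →
    multiplicity (map (false ∷_) Bs) zero ≡ 0 × multiplicity (map (true ∷_) Bs) zero ≡ length Bs
  multiplicity-lift-new []       = refl , refl
  multiplicity-lift-new (B ∷ Bs) with multiplicity-lift-new Bs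
  ... | absent , present = absent , cong suc present

  multiplicity-lift-old : ∀ {n} b (Bs : List (Subset n)) i →
    multiplicity (map (b ∷_) Bs) (suc i) ≡ multiplicity Bs i
  multiplicity-lift-old b []       i = refl
  multiplicity-lift-old b (B ∷ Bs) i = cong (member B i +_) (multiplicity-lift-old b Bs i)

  zeros : ∀ n → ℕ → List (Subset (suc n))
  zeros n q = replicate q ⁅ zero ⁆

  multiplicity-zeros-new : ∀ {n} q → multiplicity (zeros n q) zero ≡ q
  multiplicity-zeros-new zero    = refl
  multiplicity-zeros-new (suc q) = cong suc (multiplicity-zeros-new q)

  multiplicity-zeros-old : ∀ {n} q (i : Fin n) → multiplicity (zeros n q) (suc i) ≡ 0
  multiplicity-zeros-old zero    i = refl
  multiplicity-zeros-old (suc q) i rewrite lookup-replicate i false = multiplicity-zeros-old q i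

  IsPair IsSingleton : ∀ {n} → Subset n → Set
  IsPair      B = ∣ B ∣ ≡ 2
  IsSingleton B = ∣ B ∣ ≡ 1

  -- A cover of v ∈ ℕⁿ by k slots: each slot holds a pair, a singleton or
  -- nothing, the multiplicities of the occupied slots are the entries of v,
  -- and pairs only appear once no slot is empty.
  record SlotCover {n} (k : ℕ) (v : Vec ℕ n) : Set where
    field
      pairs singles    : List (Subset n)
      empty            : ℕ
      slot-count       : length pairs + length singles + empty ≡ k
      full-or-pairless : empty ≡ 0 ⊎ pairs ≡ []
      weight           : 2 * length pairs + length singles ≡ sum v
      all-pairs        : All IsPair pairs
      all-singles      : All IsSingleton singles
      covers           : ∀ i → multiplicity pairs i + multiplicity singles i ≡ lookup v i

  -- Greedy step for a new first coordinate a: put {0} into min(a, E) empty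
  -- slots and add 0 to a ∸ E of the singletons, turning them into pairs.
  module Extend {n k} (a : ℕ) (v : Vec ℕ n) (a≤k : a ≤ k) (total≤2k : a + sum v ≤ 2 * k)
                (C : SlotCover k v) where
    open SlotCover C

    upgraded filled : ℕ
    upgraded = a ∸ empty
    filled   = a ⊓ empty

    upgraded+filled : upgraded + filled ≡ a
    upgraded+filled = trans (+-comm upgraded filled)
                            (trans (cong (_+ upgraded) (⊓-comm a empty)) (m⊓n+n∸m≡n empty a))

    -- There are enough singletons to upgrade: if no slot is empty this follows
    -- from the weight bound, and without pairs from a ≤ k.
    enough-singles : upgraded ≤ length singles
    enough-singles with full-or-pairless
    ... | inj₁ empty≡0 =
      ≤-trans (m∸n≤m a empty)
        (+-cancelʳ-≤ (2 * p + s) a s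
          (≤-trans (subst (λ t → a + t ≤ 2 * k) (sym weight) total≤2k)
                   (≤-reflexive (trans (cong (2 *_) (sym full)) (double p s)))))
      where
      p s : ℕ
      p = length pairs
      s = length singles
      full : p + s ≡ k
      full = trans (sym (+-identityʳ (p + s))) (subst (λ e → p + s + e ≡ k) empty≡0 slot-count)
      double : ∀ p s → 2 * (p + s) ≡ s + (2 * p + s)
      double = solve-∀
    ... | inj₂ pairs≡[] =
      ≤-trans (∸-monoˡ-≤ empty a≤k)
        (≤-reflexive (trans (cong (_∸ empty) (sym (subst (λ P → length P + length singles + empty ≡ k) pairs≡[] slot-count)))
                            (m+n∸n≡m (length singles) empty)))

    pairs′ singles′ : List (Subset (suc n))
    pairs′   = map (false ∷_) pairs ++ map (true ∷_) (take upgraded singles)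
    singles′ = zeros n filled ++ map (false ∷_) (drop upgraded singles)

    length-taken : length (take upgraded singles) ≡ upgraded
    length-taken = trans (length-take upgraded singles) (m≤n⇒m⊓n≡m enough-singles)

    length-pairs′ : length pairs′ ≡ length pairs + upgraded
    length-pairs′ = trans (length-++ (map (false ∷_) pairs))
      (cong₂ _+_ (length-map (false ∷_) pairs) (trans (length-map (true ∷_) (take upgraded singles)) length-taken))

    length-singles′ : length singles′ ≡ filled + (length singles ∸ upgraded)
    length-singles′ = trans (length-++ (zeros n filled))
      (cong₂ _+_ (length-replicate filled)
                 (trans (length-map (false ∷_) (drop upgraded singles)) (length-drop upgraded singles)))

    slot-count′ : length pairs′ + length singles′ + (empty ∸ a) ≡ k
    slot-count′ = begin
        length pairs′ + length singles′ + (empty ∸ a)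
      ≡⟨ cong₂ (λ p s → p + s + (empty ∸ a)) length-pairs′ length-singles′ ⟩
        length pairs + upgraded + (filled + (length singles ∸ upgraded)) + (empty ∸ a)
      ≡⟨ regroup (length pairs) upgraded filled (length singles ∸ upgraded) (empty ∸ a) ⟩
        length pairs + (upgraded + (length singles ∸ upgraded)) + (filled + (empty ∸ a))
      ≡⟨ cong₂ (λ s e → length pairs + s + e) (m+[n∸m]≡n enough-singles) (m⊓n+n∸m≡n a empty) ⟩
        length pairs + length singles + empty
      ≡⟨ slot-count ⟩
        k
      ∎
      where
      regroup : ∀ p u f d e → p + u + (f + d) + e ≡ p + (u + d) + (f + e)
      regroup = solve-∀

    weight′ : 2 * length pairs′ + length singles′ ≡ a + sum v
    weight′ = begin
        2 * length pairs′ + length singles′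
      ≡⟨ cong₂ (λ p s → 2 * p + s) length-pairs′ length-singles′ ⟩
        2 * (length pairs + upgraded) + (filled + (length singles ∸ upgraded))
      ≡⟨ regroup (length pairs) upgraded filled (length singles ∸ upgraded) ⟩
        (upgraded + filled) + (2 * length pairs + (upgraded + (length singles ∸ upgraded)))
      ≡⟨ cong₂ (λ u s → u + (2 * length pairs + s)) upgraded+filled (m+[n∸m]≡n enough-singles) ⟩
        a + (2 * length pairs + length singles)
      ≡⟨ cong (a +_) weight ⟩
        a + sum v
      ∎
      where
      regroup : ∀ p u f d → 2 * (p + u) + (f + d) ≡ (u + f) + (2 * p + (u + d))
      regroup = solve-∀

    covers′ : ∀ i → multiplicity pairs′ i + multiplicity singles′ i ≡ lookup (a ∷ v) i
    covers′ zero
      rewrite multiplicity-++ (map (false ∷_) pairs) (map (true ∷_) (take upgraded singles)) zero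
            | multiplicity-++ (zeros n filled) (map (false ∷_) (drop upgraded singles)) zero
            | proj₁ (multiplicity-lift-new pairs) | proj₂ (multiplicity-lift-new (take upgraded singles))
            | proj₁ (multiplicity-lift-new (drop upgraded singles)) | multiplicity-zeros-new {n} filled
            | length-taken | +-identityʳ filled = upgraded+filled
    covers′ (suc i)
      rewrite multiplicity-++ (map (false ∷_) pairs) (map (true ∷_) (take upgraded singles)) (suc i)
            | multiplicity-++ (zeros n filled) (map (false ∷_) (drop upgraded singles)) (suc i)
            | multiplicity-lift-old false pairs i | multiplicity-lift-old true (take upgraded singles) i
            | multiplicity-lift-old false (drop upgraded singles) i | multiplicity-zeros-old filled i
            | +-assoc (multiplicity pairs i) (multiplicity (take upgraded singles) i) (multiplicity (drop upgraded singles) i)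
            | multiplicity-take-drop upgraded singles i = covers i

    -- If a ≤ empty nothing is upgraded and the old invariant persists;
    -- otherwise every slot gets occupied.
    full-or-pairless′ : empty ∸ a ≡ 0 ⊎ pairs′ ≡ []
    full-or-pairless′ with a ≤? empty | full-or-pairless
    ... | no  a≰empty | _ = inj₁ (m≤n⇒m∸n≡0 (<⇒≤ (≰⇒> a≰empty)))
    ... | yes _       | inj₁ empty≡0 = inj₁ (trans (cong (_∸ a) empty≡0) (0∸n≡0 a))
    ... | yes a≤empty | inj₂ pairs≡[]
      rewrite pairs≡[] | m≤n⇒m∸n≡0 a≤empty = inj₂ refl

    extended : SlotCover k (a ∷ v)
    extended = record
      { pairs            = pairs′
      ; singles          = singles′
      ; empty            = empty ∸ a
      ; slot-count       = slot-count′
      ; full-or-pairless = full-or-pairless′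
      ; weight           = weight′
      ; all-pairs        = ++⁺ (map⁺ all-pairs) (gmap⁺ (cong suc) (take⁺ upgraded all-singles))
      ; all-singles      = ++⁺ (replicate⁺ filled (∣⁅x⁆∣≡1 {n = suc n} zero)) (map⁺ (drop⁺ upgraded all-singles))
      ; covers           = covers′
      }

  slotCover : ∀ {n} k (v : Vec ℕ n) → (∀ i → lookup v i ≤ k) → sum v ≤ 2 * k → SlotCover k v
  slotCover k []      _   _ = record
    { pairs = [] ; singles = [] ; empty = k ; slot-count = refl ; full-or-pairless = inj₂ refl
    ; weight = refl ; all-pairs = [] ; all-singles = [] ; covers = λ () }
  slotCover k (a ∷ v) v≤k total≤2k =
    Extend.extended a v (v≤k zero) total≤2k
      (slotCover k v (λ i → v≤k (suc i)) (≤-trans (m≤n+m (sum v) a) total≤2k))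

  exact-weight : ∀ p s e k → p + s + e ≡ k → 2 * p + s ≡ 2 * k → e ≡ 0 ⊎ p ≡ 0 → s ≡ 0 × p ≡ k
  exact-weight p s e k slots weight (inj₁ refl) = s≡0 , trans (sym p+0+0≡p) (subst (λ t → p + t + 0 ≡ k) s≡0 slots)
    where
    s≡0 : s ≡ 0
    s≡0 = +-cancelˡ-≡ (2 * p + s) s 0
            (trans (double p s) (trans (cong (2 *_) slots) (trans (sym weight) (sym (+-identityʳ _)))))
      where
      double : ∀ p s → 2 * p + s + s ≡ 2 * (p + s + 0)
      double = solve-∀
    p+0+0≡p : p + 0 + 0 ≡ p
    p+0+0≡p = trans (+-identityʳ (p + 0)) (+-identityʳ p)
  exact-weight p s e k slots weight (inj₂ refl) = trans weight (cong (2 *_) k≡0) , sym k≡0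
    where
    k≡0 : k ≡ 0
    k≡0 = m+n≡0⇒m≡0 k (+-cancelˡ-≡ k (k + e) 0
            (trans (regroup k e) (trans (cong (_+ e) (sym weight)) (trans slots (sym (+-identityʳ k))))))
      where
      regroup : ∀ k e → k + (k + e) ≡ 2 * k + e
      regroup = solve-∀

  pair-decomposition : ∀ {n} k (v : Vec ℕ n) → (∀ i → lookup v i ≤ k) → sum v ≡ 2 * k →
    Σ (List (Subset n)) λ F → length F ≡ k × All IsPair F × (∀ i → multiplicity F i ≡ lookup v i)
  pair-decomposition k v v≤k total≡2k with slotCover k v v≤k (≤-reflexive total≡2k)
  ... | record { pairs = F ; singles = S ; empty = e ; slot-count = slots ; full-or-pairless = inv
               ; weight = weight ; all-pairs = F-pairs ; covers = covers }
    with exact-weight (length F) (length S) e k slots (trans weight total≡2k) (map₂ (cong length) inv)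
  ... | no-singles , |F|≡k with S
  ... | []    = F , |F|≡k , F-pairs , λ i → trans (sym (+-identityʳ _)) (covers i)
  ... | _ ∷ _ with no-singles
  ...   | ()

module LatticePoints where

  open import Defs
  open RationalEmbedding
  open BoundedVectors using (Bounded; bounded; bounded-sound; bounded-complete; bounded-unique)
  open Decomposition using (member; multiplicity; IsPair; pair-decomposition)
  open import Data.Nat as ℕ using (ℕ; zero; suc; z≤n; s≤s)
  import Data.Nat.Properties as ℕP
  open import Data.Integer as ℤ using (ℤ) renaming (+_ to pos)
  import Data.Integer.Properties as ℤP
  open import Data.Rational as ℚ using (ℚ; 0ℚ; 1ℚ; _+_; _*_; _≤_)
  import Data.Rational.Properties as ℚP
  open import Algebra.Bundles using (Ring)
  open import Algebra.Properties.Semiring.Sum (Ring.semiring ℚP.+-*-ring)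
    using (∑-distrib-+; *-distribˡ-sum; sum-cong-≗; sum-replicate-zero) renaming (sum to ∑)
  open import Data.Bool using (true; false)
  open import Data.Fin using (Fin; zero; suc)
  open import Data.Fin.Subset using (Subset; ∣_∣) renaming (⊥ to ∅)
  open import Data.Fin.Subset.Properties using (∣⊥∣≡0)
  open import Data.Vec as Vec using (Vec; []; _∷_; lookup; sum)
  open import Data.Vec.Properties using (lookup-map)
  open import Data.List using (List; []; _∷_; map; length)
  open import Data.List.Relation.Unary.All using (All; []; _∷_)
  open import Data.List.Membership.Propositional using (_∈_)
  open import Data.List.Membership.Propositional.Properties using (∈-map⁺; ∈-map⁻)
  import Data.List.Relation.Unary.Unique.Propositional.Properties as Unique
  open import Function.Bundles using (mk⇔)
  open import Data.Product using (_×_; _,_; proj₁; proj₂; Σ)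
  open import Relation.Binary.PropositionalEquality
  open ≡-Reasoning

  Combination : ℕ → Set
  Combination n = List (ℚ × Subset n)

  point : ∀ {n} → Combination n → Fin n → ℚ
  point comb i = sumℚ (map (λ p → proj₁ p * indicator (proj₂ p) i) comb)

  weights : ∀ {n} → Combination n → ℚ
  weights comb = sumℚ (map proj₁ comb)

  Admissible : ∀ {n} → Combination n → Set
  Admissible = All (λ p → (0ℚ ≤ proj₁ p) × IsBasisU 2 (proj₂ p))

  ∑-indicator : ∀ {n} (B : Subset n) → ∑ (indicator B) ≡ ℕ→ℚ ∣ B ∣
  ∑-indicator []          = refl
  ∑-indicator (true  ∷ B) = trans (cong (1ℚ +_) (∑-indicator B)) (sym (ℕ→ℚ-+ 1 ∣ B ∣))
  ∑-indicator (false ∷ B) = trans (ℚP.+-identityˡ _) (∑-indicator B)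

  ∑-point : ∀ {n} (comb : Combination n) → Admissible comb → ∑ (point comb) ≡ weights comb * ℕ→ℚ 2
  ∑-point {n} []              []              = trans (sum-replicate-zero n) (sym (ℚP.*-zeroˡ (ℕ→ℚ 2)))
  ∑-point     ((w , B) ∷ comb) ((_ , |B|≡2) ∷ adm) = begin
      ∑ (λ i → w * indicator B i + point comb i)
    ≡⟨ ∑-distrib-+ (λ i → w * indicator B i) (point comb) ⟩
      ∑ (λ i → w * indicator B i) + ∑ (point comb)
    ≡⟨ cong₂ _+_ (sym (*-distribˡ-sum w (indicator B))) (∑-point comb adm) ⟩
      w * ∑ (indicator B) + weights comb * ℕ→ℚ 2
    ≡⟨ cong (λ u → w * u + weights comb * ℕ→ℚ 2) (trans (∑-indicator B) (cong ℕ→ℚ |B|≡2)) ⟩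
      w * ℕ→ℚ 2 + weights comb * ℕ→ℚ 2
    ≡⟨ sym (ℚP.*-distribʳ-+ (ℕ→ℚ 2) w (weights comb)) ⟩
      (w + weights comb) * ℕ→ℚ 2
    ∎

  point-bounds : ∀ {n} (comb : Combination n) i → Admissible comb →
    0ℚ ≤ point comb i × point comb i ≤ weights comb
  point-bounds []               i []              = ℚP.≤-refl , ℚP.≤-refl
  point-bounds ((w , B) ∷ comb) i ((0≤w , _) ∷ adm) with point-bounds comb i adm | lookup B i
  ... | lower , upper | true  rewrite ℚP.*-identityʳ w = ℚP.+-mono-≤ 0≤w lower , ℚP.+-monoʳ-≤ w upper
  ... | lower , upper | false rewrite ℚP.*-zeroʳ w =
    ℚP.+-mono-≤ (ℚP.≤-refl {0ℚ}) lower , ℚP.+-mono-≤ 0≤w upper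

  ℕ→ℚ-sum : ∀ {n} (v : Vec ℕ n) → ℕ→ℚ (sum v) ≡ ∑ (λ i → ℕ→ℚ (lookup v i))
  ℕ→ℚ-sum []      = refl
  ℕ→ℚ-sum (a ∷ v) = trans (ℕ→ℚ-+ a (sum v)) (cong (ℕ→ℚ a +_) (ℕ→ℚ-sum v))

  toℤ : ∀ {n} → Vec ℕ n → Vec ℤ n
  toℤ = Vec.map pos

  toℤ-injective : ∀ {n} {u v : Vec ℕ n} → toℤ u ≡ toℤ v → u ≡ v
  toℤ-injective {u = []}    {[]}    _  = refl
  toℤ-injective {u = a ∷ u} {b ∷ v} eq =
    cong₂ _∷_ (ℤP.+-injective (cong Vec.head eq)) (toℤ-injective (cong Vec.tail eq))

  -- A lattice point x = k·y of the dilate has 0 ≤ xᵢ ≤ k, since 0 ≤ yᵢ ≤ 1,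
  -- and Σ xᵢ = 2k, since Σ yᵢ = 2.
  lattice→bounded : ∀ {n} k (x : Vec ℤ n) → InDilateU 2 k x →
    Σ (Vec ℕ n) λ v → x ≡ toℤ v × Bounded k (2 ℕ.* k) v
  lattice→bounded {n} k x (y , (comb , adm , weights≡1 , y≡point) , x≡ky) =
    v , sym (toℤ∘abs x 0≤x) , v≤k , Σv≡2k
    where
    K : ℚ
    K = ℕ→ℚ k
    instance
      K-nonNegative : ℚ.NonNegative K
      K-nonNegative = ℚ.nonNegative (ℕ→ℚ-nonNegative k)
    y-bounds : ∀ i → 0ℚ ≤ y i × y i ≤ 1ℚ
    y-bounds i with point-bounds comb i adm
    ... | lower , upper = subst (0ℚ ≤_) (sym (y≡point i)) lower
                        , subst₂ _≤_ (sym (y≡point i)) weights≡1 upper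
    0≤x : ∀ i → pos 0 ℤ.≤ lookup x i
    0≤x i = ℤ→ℚ-cancel-≤ (subst (0ℚ ≤_) (sym (x≡ky i))
              (subst (_≤ K * y i) (ℚP.*-zeroʳ K) (ℚP.*-monoˡ-≤-nonNeg K (proj₁ (y-bounds i)))))
    x≤k : ∀ i → lookup x i ℤ.≤ pos k
    x≤k i = ℤ→ℚ-cancel-≤ (subst (_≤ K) (sym (x≡ky i))
              (subst (K * y i ≤_) (ℚP.*-identityʳ K) (ℚP.*-monoˡ-≤-nonNeg K (proj₂ (y-bounds i)))))
    toℤ∘abs : ∀ {m} (z : Vec ℤ m) → (∀ i → pos 0 ℤ.≤ lookup z i) → toℤ (Vec.map ℤ.∣_∣ z) ≡ z
    toℤ∘abs []      _   = refl
    toℤ∘abs (a ∷ z) 0≤z = cong₂ _∷_ (ℤP.0≤i⇒+∣i∣≡i (0≤z zero)) (toℤ∘abs z (λ i → 0≤z (suc i)))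
    v : Vec ℕ n
    v = Vec.map ℤ.∣_∣ x
    v≡x : ∀ i → pos (lookup v i) ≡ lookup x i
    v≡x i = trans (cong pos (lookup-map i ℤ.∣_∣ x)) (ℤP.0≤i⇒+∣i∣≡i (0≤x i))
    v≤k : ∀ i → lookup v i ℕ.≤ k
    v≤k i = ℤP.drop‿+≤+ (subst (ℤ._≤ pos k) (sym (v≡x i)) (x≤k i))
    Σv≡2k : sum v ≡ 2 ℕ.* k
    Σv≡2k = ℕ→ℚ-injective (begin
        ℕ→ℚ (sum v)
      ≡⟨ ℕ→ℚ-sum v ⟩
        ∑ (λ i → ℕ→ℚ (lookup v i))
      ≡⟨ sum-cong-≗ (λ i → trans (cong ℤ→ℚ (v≡x i)) (x≡ky i)) ⟩
        ∑ (λ i → K * y i)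
      ≡⟨ sym (*-distribˡ-sum K y) ⟩
        K * ∑ y
      ≡⟨ cong (K *_) (trans (sum-cong-≗ y≡point) (∑-point comb adm)) ⟩
        K * (weights comb * ℕ→ℚ 2)
      ≡⟨ cong (λ u → K * (u * ℕ→ℚ 2)) weights≡1 ⟩
        K * (1ℚ * ℕ→ℚ 2)
      ≡⟨ cong (K *_) (ℚP.*-identityˡ (ℕ→ℚ 2)) ⟩
        K * ℕ→ℚ 2
      ≡⟨ ℚP.*-comm K (ℕ→ℚ 2) ⟩
        ℕ→ℚ 2 * K
      ≡⟨ sym (ℕ→ℚ-* 2 k) ⟩
        ℕ→ℚ (2 ℕ.* k)
      ∎)

  indicator≡member : ∀ {n} (B : Subset n) i → indicator B i ≡ ℕ→ℚ (member B i)
  indicator≡member B i with lookup B i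
  ... | true  = refl
  ... | false = refl

  uniform : ∀ {n} → ℚ → List (Subset n) → Combination n
  uniform w = map (w ,_)

  weights-uniform : ∀ {n} w (F : List (Subset n)) → weights (uniform w F) ≡ ℕ→ℚ (length F) * w
  weights-uniform w []      = sym (ℚP.*-zeroˡ w)
  weights-uniform w (B ∷ F) = begin
      w + weights (uniform w F)
    ≡⟨ cong₂ _+_ (sym (ℚP.*-identityˡ w)) (weights-uniform w F) ⟩
      1ℚ * w + ℕ→ℚ (length F) * w
    ≡⟨ sym (ℚP.*-distribʳ-+ w 1ℚ (ℕ→ℚ (length F))) ⟩
      (1ℚ + ℕ→ℚ (length F)) * w
    ≡⟨ cong (_* w) (sym (ℕ→ℚ-+ 1 (length F))) ⟩
      ℕ→ℚ (suc (length F)) * w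
    ∎

  point-uniform : ∀ {n} w (F : List (Subset n)) i → point (uniform w F) i ≡ w * ℕ→ℚ (multiplicity F i)
  point-uniform w []      i = sym (ℚP.*-zeroʳ w)
  point-uniform w (B ∷ F) i = begin
      w * indicator B i + point (uniform w F) i
    ≡⟨ cong₂ _+_ (cong (w *_) (indicator≡member B i)) (point-uniform w F i) ⟩
      w * ℕ→ℚ (member B i) + w * ℕ→ℚ (multiplicity F i)
    ≡⟨ sym (ℚP.*-distribˡ-+ w (ℕ→ℚ (member B i)) _) ⟩
      w * (ℕ→ℚ (member B i) + ℕ→ℚ (multiplicity F i))
    ≡⟨ cong (w *_) (sym (ℕ→ℚ-+ (member B i) (multiplicity F i))) ⟩
      w * ℕ→ℚ (multiplicity (B ∷ F) i)
    ∎

  admissible-uniform : ∀ {n} w (F : List (Subset n)) → 0ℚ ≤ w → All IsPair F → Admissible (uniform w F)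
  admissible-uniform w []      _   []               = []
  admissible-uniform w (B ∷ F) 0≤w (|B|≡2 ∷ F-pairs) = (0≤w , |B|≡2) ∷ admissible-uniform w F 0≤w F-pairs

  -- Conversely (for n ≥ 2) each such v is a lattice point: v = Σ_{B ∈ F} e_B for
  -- k pairs F, so v/k is the uniform average of the e_B; for k = 0 any e_B works.
  bounded→lattice : ∀ m k (v : Vec ℕ (suc (suc m))) → Bounded k (2 ℕ.* k) v → InDilateU 2 k (toℤ v)
  bounded→lattice m zero v (v≤0 , _) =
    point comb , (comb , (ℕ→ℚ-nonNegative 1 , |B|≡2) ∷ [] , ℚP.+-identityʳ 1ℚ , λ i → refl) , origin
    where
    B : Subset (suc (suc m))
    B = true ∷ true ∷ ∅
    |B|≡2 : ∣ B ∣ ≡ 2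
    |B|≡2 = cong (λ u → suc (suc u)) (∣⊥∣≡0 m)
    comb : Combination (suc (suc m))
    comb = (1ℚ , B) ∷ []
    origin : ∀ i → ℤ→ℚ (lookup (toℤ v) i) ≡ ℕ→ℚ 0 * point comb i
    origin i = trans (cong ℤ→ℚ (trans (lookup-map i pos v) (cong pos (ℕP.n≤0⇒n≡0 (v≤0 i)))))
                     (sym (ℚP.*-zeroˡ (point comb i)))
  bounded→lattice m (suc k) v (v≤k , Σv≡2k) with pair-decomposition (suc k) v v≤k Σv≡2k
  ... | F , |F|≡k , F-pairs , multiplicity≡v =
    point comb , (comb , admissible-uniform w F 0≤w F-pairs , weights≡1 , λ i → refl) , x≡Ky
    where
    K : ℚ
    K = ℕ→ℚ (suc k)
    instance
      K-positive : ℚ.Positive K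
      K-positive = ℕ→ℚ-positive {suc k} (s≤s z≤n)
      K-nonZero : ℚ.NonZero K
      K-nonZero = ℚP.pos⇒nonZero K
    w : ℚ
    w = ℚ.1/ K
    0≤w : 0ℚ ≤ w
    0≤w = ℚP.<⇒≤ (ℚP.positive⁻¹ w {{ℚP.1/pos⇒pos K}})
    K*w≡1 : K * w ≡ 1ℚ
    K*w≡1 = ℚP.*-inverseʳ K
    comb : Combination (suc (suc m))
    comb = uniform w F
    weights≡1 : weights comb ≡ 1ℚ
    weights≡1 = trans (weights-uniform w F) (trans (cong (λ u → ℕ→ℚ u * w) |F|≡k) K*w≡1)
    x≡Ky : ∀ i → ℤ→ℚ (lookup (toℤ v) i) ≡ K * point comb i
    x≡Ky i = begin
        ℤ→ℚ (lookup (toℤ v) i)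
      ≡⟨ cong ℤ→ℚ (trans (lookup-map i pos v) (cong pos (sym (multiplicity≡v i)))) ⟩
        ℕ→ℚ (multiplicity F i)
      ≡⟨ sym (trans (cong (_* ℕ→ℚ (multiplicity F i)) K*w≡1) (ℚP.*-identityˡ _)) ⟩
        K * w * ℕ→ℚ (multiplicity F i)
      ≡⟨ ℚP.*-assoc K w _ ⟩
        K * (w * ℕ→ℚ (multiplicity F i))
      ≡⟨ cong (K *_) (sym (point-uniform w F i)) ⟩
        K * point comb i
      ∎

  latticePoints : ∀ m k →
    EnumeratesLatticePoints 2 (suc (suc m)) k (map toℤ (bounded (suc (suc m)) k (2 ℕ.* k)))
  latticePoints m k = Unique.map⁺ toℤ-injective (bounded-unique n k (2 ℕ.* k)) , λ x → mk⇔ (to x) (from x)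
    where
    n : ℕ
    n = suc (suc m)
    to : ∀ x → x ∈ map toℤ (bounded n k (2 ℕ.* k)) → InDilateU 2 k x
    to x x∈ with ∈-map⁻ toℤ x∈
    ... | v , v∈ , refl = bounded→lattice m k v (bounded-sound n k (2 ℕ.* k) v v∈)
    from : ∀ x → InDilateU 2 k x → x ∈ map toℤ (bounded n k (2 ℕ.* k))
    from x x∈kP = listed (lattice→bounded k x x∈kP)
      where
      listed : (Σ (Vec ℕ n) λ v → x ≡ toℤ v × Bounded k (2 ℕ.* k) v) → x ∈ map toℤ (bounded n k (2 ℕ.* k))
      listed (v , x≡v , v-bounded) = subst (_∈ map toℤ (bounded n k (2 ℕ.* k))) (sym x≡v)
                                           (∈-map⁺ toℤ (bounded-complete n k (2 ℕ.* k) v v-bounded))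

open import Defs
open import Data.Nat using (ℕ; _≥_)
open import Data.Integer using (ℤ)
open import Data.Rational using (ℚ; 0ℚ; _<_)
open import Data.Vec using (Vec)
open import Data.List using (List; length)
open import Data.List.Relation.Unary.All using (All)
open import Data.Product using (Σ; _×_)
open import Relation.Binary.PropositionalEquality using (_≡_)

open import Data.Nat as ℕ using (zero; suc; z≤n; s≤s; _!)
import Data.Nat.Properties as ℕP
import Data.Rational as Rat
open Rat using (_+_; _*_)
import Data.Rational.Properties as ℚP
open import Data.List using ([]; _∷_; map)
open import Data.List.Properties using (length-map)
open import Data.List.Relation.Unary.All using ([]; _∷_)
open import Data.Product using (_,_)
open import Relation.Binary.PropositionalEquality using (sym; trans; cong)
open Relation.Binary.PropositionalEquality.≡-Reasoning
open RationalEmbedding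
open Polynomials using (horner; rising)
open EhrhartCoefficients using (numerator; numerator-expansion; numerator-support)
open BoundedVectors using (bounded)
open BoundedCount using (countFormula)
open LatticePoints using (toℤ; latticePoints)

coefficients : (ℕ → ℚ) → ℕ → List ℚ
coefficients g zero    = []
coefficients g (suc L) = g 0 ∷ coefficients (λ j → g (suc j)) L

evalPoly-coefficients : ∀ c (f : ℕ → ℕ) L x →
  evalPoly (coefficients (λ j → ℕ→ℚ (f j) * c) L) (ℕ→ℚ x) ≡ ℕ→ℚ (horner f L x) * c
evalPoly-coefficients c f zero    x = sym (ℚP.*-zeroˡ c)
evalPoly-coefficients c f (suc L) x = begin
    ℕ→ℚ (f 0) * c + ℕ→ℚ x * evalPoly (coefficients (λ j → ℕ→ℚ (f (suc j)) * c) L) (ℕ→ℚ x)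
  ≡⟨ cong (λ u → ℕ→ℚ (f 0) * c + ℕ→ℚ x * u) (evalPoly-coefficients c (λ j → f (suc j)) L x) ⟩
    ℕ→ℚ (f 0) * c + ℕ→ℚ x * (ℕ→ℚ (horner f′ L x) * c)
  ≡⟨ cong (ℕ→ℚ (f 0) * c +_) (sym (ℚP.*-assoc (ℕ→ℚ x) _ c)) ⟩
    ℕ→ℚ (f 0) * c + ℕ→ℚ x * ℕ→ℚ (horner f′ L x) * c
  ≡⟨ sym (ℚP.*-distribʳ-+ c (ℕ→ℚ (f 0)) _) ⟩
    (ℕ→ℚ (f 0) + ℕ→ℚ x * ℕ→ℚ (horner f′ L x)) * c
  ≡⟨ cong (_* c) (sym (trans (ℕ→ℚ-+ (f 0) _) (cong (ℕ→ℚ (f 0) +_) (ℕ→ℚ-* x _)))) ⟩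
    ℕ→ℚ (horner f (suc L) x) * c
  ∎
  where
  f′ : ℕ → ℕ
  f′ j = f (suc j)

coefficients-positive : ∀ L (g : ℕ → ℚ) → (∀ j → j ℕ.< L → 0ℚ < g j) → All (0ℚ <_) (coefficients g L)
coefficients-positive zero    g _        = []
coefficients-positive (suc L) g positive =
  positive 0 (s≤s z≤n) ∷ coefficients-positive L (λ j → g (suc j)) (λ j j<L → positive (suc j) (s≤s j<L))

scaled-count : ∀ m k →
  suc m ! ℕ.* length (bounded (suc (suc m)) k (2 ℕ.* k)) ≡ horner (numerator (suc m)) (suc (suc m)) k
scaled-count m k = numerator-expansion (suc m) k _ (begin
    suc m ! ℕ.* B ℕ.+ suc (suc m) ℕ.* rising-k
  ≡⟨ cong (λ u → suc m ! ℕ.* B ℕ.+ suc (suc m) ℕ.* rising (suc m) u) (sym 2k∸k≡k) ⟩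
    suc m ! ℕ.* B ℕ.+ suc (suc m) ℕ.* rising (suc m) (2 ℕ.* k ℕ.∸ k)
  ≡⟨ countFormula k m (2 ℕ.* k) ℕP.≤-refl ⟩
    rising (suc m) (suc (2 ℕ.* k))
  ≡⟨ cong (rising (suc m)) (ℕP.+-comm 1 (2 ℕ.* k)) ⟩
    rising (suc m) (2 ℕ.* k ℕ.+ 1)
  ∎)
  where
  B rising-k : ℕ
  B = length (bounded (suc (suc m)) k (2 ℕ.* k))
  rising-k = rising (suc m) k
  2k∸k≡k : 2 ℕ.* k ℕ.∸ k ≡ k
  2k∸k≡k = trans (ℕP.m+n∸m≡n k (k ℕ.+ 0)) (ℕP.+-identityʳ k)

divide-factor : ∀ a b .{{_ : Rat.NonZero (ℕ→ℚ a)}} → ℕ→ℚ (a ℕ.* b) * Rat.1/ ℕ→ℚ a ≡ ℕ→ℚ b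
divide-factor a b = begin
    ℕ→ℚ (a ℕ.* b) * Rat.1/ ℕ→ℚ a
  ≡⟨ cong (_* Rat.1/ ℕ→ℚ a) (trans (ℕ→ℚ-* a b) (ℚP.*-comm (ℕ→ℚ a) (ℕ→ℚ b))) ⟩
    ℕ→ℚ b * ℕ→ℚ a * Rat.1/ ℕ→ℚ a
  ≡⟨ ℚP.*-assoc (ℕ→ℚ b) (ℕ→ℚ a) _ ⟩
    ℕ→ℚ b * (ℕ→ℚ a * Rat.1/ ℕ→ℚ a)
  ≡⟨ cong (ℕ→ℚ b *_) (ℚP.*-inverseʳ (ℕ→ℚ a)) ⟩
    ℕ→ℚ b * Rat.1ℚ
  ≡⟨ ℚP.*-identityʳ (ℕ→ℚ b) ⟩
    ℕ→ℚ b
  ∎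

lemma3p1 : (n : ℕ) → n ≥ 2 →
    Σ (List ℚ) λ cs →
        All (λ c → 0ℚ < c) cs
      × ((k : ℕ) → Σ (List (Vec ℤ n)) λ L →
            EnumeratesLatticePoints 2 n k L × (ℕ→ℚ (length L) ≡ evalPoly cs (ℕ→ℚ k)))
lemma3p1 (suc (suc m)) (s≤s (s≤s z≤n)) with numerator-support m
... | L , numerator>0 , trimmed =
  coefficients c L , coefficients-positive L c c>0 , λ k → points k , latticePoints m k , count k
  where
  N! : ℚ
  N! = ℕ→ℚ (suc m !)
  instance
    N!-positive : Rat.Positive N!
    N!-positive = ℕ→ℚ-positive (ℕP.1≤n! (suc m))
    N!-nonZero : Rat.NonZero N!
    N!-nonZero = ℚP.pos⇒nonZero N!
  c : ℕ → ℚ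
  c j = ℕ→ℚ (numerator (suc m) j) * Rat.1/ N!
  c>0 : ∀ j → j ℕ.< L → 0ℚ < c j
  c>0 j j<L = ℚP.positive⁻¹ (c j)
    {{ℚP.pos*pos⇒pos (ℕ→ℚ (numerator (suc m) j)) {{ℕ→ℚ-positive (numerator>0 j j<L)}}
                     (Rat.1/ N!) {{ℚP.1/pos⇒pos N!}}}}
  points : ℕ → List (Vec ℤ (suc (suc m)))
  points k = map toℤ (bounded (suc (suc m)) k (2 ℕ.* k))
  count : ∀ k → ℕ→ℚ (length (points k)) ≡ evalPoly (coefficients c L) (ℕ→ℚ k)
  count k = begin
      ℕ→ℚ (length (points k))
    ≡⟨ cong ℕ→ℚ (length-map toℤ (bounded (suc (suc m)) k (2 ℕ.* k))) ⟩
      ℕ→ℚ (length (bounded (suc (suc m)) k (2 ℕ.* k)))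
    ≡⟨ sym (divide-factor (suc m !) _) ⟩
      ℕ→ℚ (suc m ! ℕ.* length (bounded (suc (suc m)) k (2 ℕ.* k))) * Rat.1/ N!
    ≡⟨ cong (λ u → ℕ→ℚ u * Rat.1/ N!) (trans (scaled-count m k) (trimmed k)) ⟩
      ℕ→ℚ (horner (numerator (suc m)) L k) * Rat.1/ N!
    ≡⟨ sym (evalPoly-coefficients (Rat.1/ N!) (numerator (suc m)) L k) ⟩
      evalPoly (coefficients c L) (ℕ→ℚ k)
    ∎
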